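{- Let $G$ be an ordered abelian group, $n\ge 2$ an integer and $a, b \in G$. Then $\mathfrak{t}_n(a) = \mathfrak{t}_n(b)$ if and only if $\mathfrak{t}_n^+(a) = \mathfrak{t}_n^+(b)$, and $\mathfrak{t}_n(a) < \mathfrak{t}_n(b)$ if and only if $\mathfrak{t}_n^+(a) < \mathfrak{t}_n^+(b)$. In particular, $\mathfrak{t}_n(a) \mapsto \mathfrak{t}_n^+(a)$ is a well-defined order isomorphism from $\mathcal{T}_n$ onto $\mathcal{T}_n^+$.
   Context: Convex subgroups of $G$ are linearly ordered by inclusion, with $\emptyset$ considered smaller than every convex subgroup. For $n\ge2$, $a\in G$: if $a\notin nG$, $\mathfrak{s}_n(a)$ is the largest convex subgroup $H$ of $G$ with $a\notin H+nG$; if $a \in nG$, $\mathfrak{s}_n(a)=\emptyset$. $\mathcal{S}_n=\{\mathfrak{s}_n(a)\mid a\in G\}$; $\mathfrak{t}_n(a)=\bigcup_{H\in\mathcal{S}_n,\, a\notin H}H$; $\mathfrak{t}_n^+(a)=\bigcap_{H\in\mathcal{S}_n,\, a\in H}H$, where the empty intersection is $G$; $\mathcal{T}_n=\{\mathfrak{t}_n(a)\mid a\in G\}$ and $\mathcal{T}_n^+=\{\mathfrak{t}_n^+(a)\mid a\in G\}$. -}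

module Defs where

open import Level using (0ℓ; _⊔_) renaming (suc to lsuc)
open import Algebra.Bundles using (AbelianGroup)
open import Data.Nat.Base using (ℕ)
open import Data.Product using (Σ; ∃; ∃-syntax; _×_; _,_)
open import Relation.Binary.Core using (Rel)
open import Relation.Binary.Structures using (IsTotalOrder)
open import Relation.Nullary using (¬_)
open import Relation.Unary using (Pred; _∈_; _∉_; _⊆_; ∅)

-- Ordered abelian groups: an abelian group with a total order
-- compatible with the group operation (written multiplicatively by the
-- stdlib bundle as _∙_ / ε / _⁻¹; we think of it additively).

record OrderedAbelianGroup : Set₁ where
  field
    abelianGroup : AbelianGroup 0ℓ 0ℓ
  open AbelianGroup abelianGroup public
  field
    _≤_          : Rel Carrier 0ℓ
    isTotalOrder : IsTotalOrder _≈_ _≤_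
    ∙-monoˡ-≤    : ∀ {x y} z → x ≤ y → (x ∙ z) ≤ (y ∙ z)

module OAG (G : OrderedAbelianGroup) where
  open OrderedAbelianGroup G public
  open import Algebra.Definitions.RawMonoid rawMonoid public
    using () renaming (_×_ to _·_)

  Subset : Set₁
  Subset = Pred Carrier 0ℓ

  _≐_ : ∀ {p q} → Pred Carrier p → Pred Carrier q → Set (p ⊔ q)
  A ≐ B = (A ⊆ B) × (B ⊆ A)

  _⊂_ : ∀ {p q} → Pred Carrier p → Pred Carrier q → Set (p ⊔ q)
  A ⊂ B = (A ⊆ B) × ¬ (B ⊆ A)

  record IsSubgroup (H : Subset) : Set where
    field
      resp   : ∀ {x y} → x ≈ y → x ∈ H → y ∈ H
      ε∈     : ε ∈ H
      ∙-clos : ∀ {x y} → x ∈ H → y ∈ H → (x ∙ y) ∈ H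
      ⁻¹-clos : ∀ {x} → x ∈ H → (x ⁻¹) ∈ H

  record IsConvexSubgroup (H : Subset) : Set where
    field
      isSubgroup : IsSubgroup H
      convex     : ∀ {g h} → h ∈ H → ε ≤ g → g ≤ h → g ∈ H

  nG : ℕ → Subset
  nG n x = ∃[ g ] (x ≈ n · g)

  _+nG_ : Subset → ℕ → Subset
  (H +nG n) x = ∃[ h ] ∃[ g ] (h ∈ H × x ≈ (h ∙ (n · g)))

  -- "H is s_n(a)": if a ∈ nG then H = ∅; otherwise H is the largest
  -- convex subgroup with a ∉ H + nG.
  record IsS (n : ℕ) (a : Carrier) (H : Subset) : Set₁ where
    field
      case-in  : a ∈ nG n → H ≐ ∅
      case-out : a ∉ nG n →
                 IsConvexSubgroup H × a ∉ (H +nG n) ×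
                 (∀ (K : Subset) → IsConvexSubgroup K → a ∉ (K +nG n) → K ⊆ H)

  InS : ℕ → Subset → Set₁
  InS n H = ∃[ b ] IsS n b H

  t : ℕ → Carrier → Pred Carrier (lsuc 0ℓ)
  t n a x = ∃[ H ] (InS n H × a ∉ H × x ∈ H)

  -- t_n^+(a) = ⋂ { H ∈ S_n | a ∈ H }   (empty intersection = G)
  t⁺ : ℕ → Carrier → Pred Carrier (lsuc 0ℓ)
  t⁺ n a x = ∀ (H : Subset) → InS n H → a ∈ H → x ∈ H

-- The argument is pure set theory about the family S = 𝒮ₙ: both t(a) ⊆ t(b)
-- and t⁺(a) ⊆ t⁺(b) say that no member of S contains b but not a.  Hence the
-- two maps induce the same preorder on G, and so the same equality and strict
-- inclusion.
module Submission where

open import Defs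
open import Level using (Level; _⊔_) renaming (suc to lsuc)
open import Axiom.ExcludedMiddle using (ExcludedMiddle)
open import Data.Empty using (⊥-elim)
open import Data.Nat.Base using (ℕ; _≤_)
open import Data.Product using (_×_; _,_; ∃-syntax)
open import Data.Product.Function.NonDependent.Propositional using (_×-⇔_)
open import Function.Bundles using (_⇔_; mk⇔)
open import Function.Construct.Composition using (_⇔-∘_)
open import Function.Construct.Symmetry using (⇔-sym)
open import Function.Related.TypeIsomorphisms using (¬-cong-⇔)
open import Relation.Nullary using (¬_; yes; no)
open import Relation.Unary using (Pred; _∈_; _∉_; _⊆_)
import Relation.Unary as Set

module Family {a ℓ p : Level} {A : Set a} (S : Pred (Pred A ℓ) p) where

  ⋃-avoiding : A → Pred A (a ⊔ lsuc ℓ ⊔ p)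
  ⋃-avoiding x y = ∃[ H ] (S H × x ∉ H × y ∈ H)

  ⋂-containing : A → Pred A (a ⊔ lsuc ℓ ⊔ p)
  ⋂-containing x y = ∀ H → S H → x ∈ H → y ∈ H

  Separates : A → A → Set (a ⊔ lsuc ℓ ⊔ p)
  Separates x y = ∃[ H ] (S H × x ∈ H × y ∉ H)

  ⋃-avoiding-⊆⇔¬separates : ∀ x y → ⋃-avoiding x ⊆ ⋃-avoiding y ⇔ (¬ Separates y x)
  ⋃-avoiding-⊆⇔¬separates x y = mk⇔ to from
    where
    to : ⋃-avoiding x ⊆ ⋃-avoiding y → ¬ Separates y x
    to Ux⊆Uy (H , S-H , y∈H , x∉H) with Ux⊆Uy (H , S-H , x∉H , y∈H)
    ... | K , _ , y∉K , y∈K = y∉K y∈K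

    from : ¬ Separates y x → ⋃-avoiding x ⊆ ⋃-avoiding y
    from ¬sep (H , S-H , x∉H , z∈H) = H , S-H , (λ y∈H → ¬sep (H , S-H , y∈H , x∉H)) , z∈H

  ⋂-containing-⊆⇔¬separates : ExcludedMiddle ℓ →
    ∀ x y → ⋂-containing x ⊆ ⋂-containing y ⇔ (¬ Separates y x)
  ⋂-containing-⊆⇔¬separates em x y = mk⇔ to from
    where
    to : ⋂-containing x ⊆ ⋂-containing y → ¬ Separates y x
    to Ix⊆Iy (H , S-H , y∈H , x∉H) = x∉H (Ix⊆Iy (λ _ _ x∈K → x∈K) H S-H y∈H)

    from : ¬ Separates y x → ⋂-containing x ⊆ ⋂-containing y
    from ¬sep z∈Ix H S-H y∈H with em {x ∈ H}
    ... | yes x∈H = z∈Ix H S-H x∈H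
    ... | no x∉H = ⊥-elim (¬sep (H , S-H , y∈H , x∉H))

  ⋃-avoiding-⊆⇔⋂-containing-⊆ : ExcludedMiddle ℓ →
    ∀ x y → ⋃-avoiding x ⊆ ⋃-avoiding y ⇔ ⋂-containing x ⊆ ⋂-containing y
  ⋃-avoiding-⊆⇔⋂-containing-⊆ em x y =
    ⇔-sym (⋂-containing-⊆⇔¬separates em x y) ⇔-∘ ⋃-avoiding-⊆⇔¬separates x y

module _ {a c ℓ₁ ℓ₂ : Level} {A : Set a} {C : Set c} {U : A → Pred C ℓ₁} {I : A → Pred C ℓ₂}
         (⊆⇔⊆ : ∀ x y → U x ⊆ U y ⇔ I x ⊆ I y) where

  ≐⇔≐ : ∀ x y → U x Set.≐ U y ⇔ I x Set.≐ I y
  ≐⇔≐ x y = ⊆⇔⊆ x y ×-⇔ ⊆⇔⊆ y x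

  ⊂⇔⊂ : ∀ x y → U x Set.⊂ U y ⇔ I x Set.⊂ I y
  ⊂⇔⊂ x y = ⊆⇔⊆ x y ×-⇔ ¬-cong-⇔ (⊆⇔⊆ y x)

lemma2p4 : (∀ {ℓ : Level} → ExcludedMiddle ℓ) →
    (G : OrderedAbelianGroup) → (n : ℕ) → 2 ≤ n →
    let open OAG G in (a b : Carrier) →
      ((t n a ≐ t n b) ⇔ (t⁺ n a ≐ t⁺ n b)) ×
      ((t n a ⊂ t n b) ⇔ (t⁺ n a ⊂ t⁺ n b))
lemma2p4 em G n _ a b = ≐⇔≐ t⊆⇔t⁺⊆ a b , ⊂⇔⊂ t⊆⇔t⁺⊆ a b
  where
  open Family (OAG.InS G n)

  t⊆⇔t⁺⊆ : ∀ x y → OAG.t G n x ⊆ OAG.t G n y ⇔ OAG.t⁺ G n x ⊆ OAG.t⁺ G n y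
  t⊆⇔t⁺⊆ = ⋃-avoiding-⊆⇔⋂-containing-⊆ em
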